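{- Let $W$ be a windmill with tips $a_1,a_2,a_3$. Then $W$ contains a path of length congruent to $0$ modulo $4$ whose two endvertices are distinct elements of $\{a_1,a_2,a_3\}$ and none of whose interior vertices lies in $\{a_1,a_2,a_3\}$.
   Context: A windmill is a graph that is the union of three paths $P_1,P_2,P_3$ and three cycles $C_1,C_2,C_3$ such that: the paths $P_1,P_2,P_3$ share an endvertex $x$ but are otherwise disjoint; each cycle $C_i$ has odd length; $C_i\cap P_i$ is a path of length at least $1$ for $i=1,2,3$; and $C_i$ is disjoint from $\bigcup_{j\ne i}(P_j\cup C_j)$. The tips of the windmill are the endvertices $a_i\neq x$ of the paths $P_i$, $i=1,2,3$. Length means number of edges. -}

module Defs where

open import Data.Nat using (ℕ; suc; _≤_; _*_; _+_)
open import Data.Nat.Divisibility using (_∣_)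
open import Data.Fin using (Fin)
open import Data.List using (List; []; _∷_; _∷ʳ_; _++_; length; take)
open import Data.List.Membership.Propositional using (_∈_; _∉_)
open import Data.List.Relation.Unary.Unique.Propositional using (Unique)
open import Data.Product using (Σ; ∃; _×_; _,_)
open import Data.Sum using (_⊎_)
open import Function.Bundles using (_⇔_)
open import Relation.Binary.PropositionalEquality using (_≡_; _≢_)

-- Subgraphs are given as vertex lists over an arbitrary vertex type V.

data Consec {V : Set} : List V → V → V → Set where
  here  : ∀ {u v xs} → Consec (u ∷ v ∷ xs) u v
  there : ∀ {w u v xs} → Consec xs u v → Consec (w ∷ xs) u v

-- A path is a nonempty list of pairwise distinct vertices; its edges are the
-- consecutive (unordered) pairs; its length is (number of vertices) - 1.
IsPath : {V : Set} → List V → Set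
IsPath xs = Unique xs × (1 ≤ length xs)

PathEdge : {V : Set} → List V → V → V → Set
PathEdge xs u v = Consec xs u v ⊎ Consec xs v u

-- A path from u to v (possibly u ≡ v only if it is a single vertex).
IsPathFromTo : {V : Set} → V → V → List V → Set
IsPathFromTo u v xs = Unique xs × (Σ _ λ ys → xs ≡ u ∷ ys) × (Σ _ λ zs → xs ≡ zs ∷ʳ v)

-- A cycle v₀ … v_{k-1} (k ≥ 3, distinct) with edges v_i v_{i+1} and v_{k-1} v₀;
-- its length is k.
IsCycle : {V : Set} → List V → Set
IsCycle cs = Unique cs × (3 ≤ length cs)

CycleEdge : {V : Set} → List V → V → V → Set
CycleEdge cs u v = PathEdge (cs ++ take 1 cs) u v

Odd : ℕ → Set
Odd n = ∃ λ k → n ≡ suc (2 * k)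

IntersectionIsPath≥1 : {V : Set} → List V → List V → Set
IntersectionIsPath≥1 {V} P C =
  Σ (List V) λ Q → IsPath Q × (2 ≤ length Q)
    × (∀ v → (v ∈ Q) ⇔ (v ∈ P × v ∈ C))
    × (∀ u v → PathEdge Q u v ⇔ (PathEdge P u v × CycleEdge C u v))

record Windmill (V : Set) : Set where
  field
    x : V
    a : Fin 3 → V
    P : Fin 3 → List V
    C : Fin 3 → List V
    P-path    : ∀ i → IsPathFromTo x (a i) (P i)
    P-disj    : ∀ i j → i ≢ j → ∀ v → v ∈ P i → v ∈ P j → v ≡ x
    C-cycle   : ∀ i → IsCycle (C i)
    C-odd     : ∀ i → Odd (length (C i))
    C∩P       : ∀ i → IntersectionIsPath≥1 (P i) (C i)
    C-disj    : ∀ i j → i ≢ j → ∀ v → v ∈ C i → (v ∉ P j × v ∉ C j)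

  Edge : V → V → Set
  Edge u v = Σ (Fin 3) λ i → PathEdge (P i) u v ⊎ CycleEdge (C i) u v

GoodTipPath : {V : Set} → Windmill V → Set
GoodTipPath {V} W =
  Σ (Fin 3) λ i → Σ (Fin 3) λ j → Σ (List V) λ mid →
    let Q = a i ∷ (mid ∷ʳ a j) in
      Unique Q
    × a i ≢ a j
    × (∀ u v → Consec Q u v → Edge u v)
    × (4 ∣ suc (length mid))
    × (∀ k → a k ∉ mid)
  where open Windmill W

-- For each arm i, let u and w be the first and last vertices of P i on the
-- odd cycle C i (they differ, as P i ∩ C i has an edge). The two u–w arcs of
-- C i have lengths of opposite parity, so replacing the u–w segment of P i by
-- one of them gives an x–a i path of even length 2 mᵢ inside P i ∪ C i. Two of
-- m₀, m₁, m₂ have the same parity; the corresponding two paths meet only in x,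
-- so together they form a tip-to-tip path of length 2 mᵢ + 2 mⱼ ≡ 0 (mod 4).
module Submission where

open import Defs
open import Level using (0ℓ)
open import Function using (_∘_)
open import Function.Bundles using (Equivalence)
open import Data.Empty using (⊥-elim)
open import Data.Nat using (ℕ; zero; suc; _+_; _*_; s≤s; parity)
open import Data.Nat.Divisibility using (_∣_; divides; _∣0; ∣-refl; ∣m∣n⇒∣m+n; *-monoˡ-∣)
open import Data.Nat.Properties using (*-distribʳ-+)
open import Data.Nat.Tactic.RingSolver using (solve-∀)
open import Data.Parity.Base as ℙ using (Parity; 0ℙ; 1ℙ)
import Data.Parity.Properties as ℙ
open import Data.Fin using (Fin; zero; suc; _≟_)
open import Data.Product using (Σ; ∃; ∃₂; _×_; _,_; proj₁; proj₂)
import Data.Product as Product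
open import Data.Sum using (_⊎_; inj₁; inj₂; [_,_]′)
import Data.Sum as Sum
import Data.List as List
open import Data.List using (List; []; _∷_; _∷ʳ_; _++_; [_]; reverse; _ʳ++_; take; initLast; _∷ʳ′_)
open import Data.List.Properties using (++-assoc; ++-identityʳ; ∷ʳ-++; ∷ʳ-injectiveʳ; unfold-reverse; reverse-++; length-++; length-reverse)
open import Data.List.Membership.Propositional using (_∈_; _∉_)
open import Data.List.Membership.Propositional.Properties using (∈-++⁻; ∈-++⁺ˡ; ∈-++⁺ʳ; ∈-∃++)
open import Data.List.Relation.Unary.Any using (here; there)
open import Data.List.Relation.Unary.Any.Properties using (reverse⁻)
open import Data.List.Relation.Unary.All as All using (All; []; _∷_)
import Data.List.Relation.Unary.All.Properties as All
open import Data.List.Relation.Unary.Linked as Linked using (Linked; []; [-]; _∷_)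
open import Data.List.Relation.Unary.Unique.Propositional using (Unique; []; _∷_)
import Data.List.Relation.Unary.Unique.Propositional.Properties as Unique
open import Data.List.Relation.Binary.Subset.Propositional using (_⊆_)
open import Data.List.Relation.Binary.Disjoint.Propositional using (Disjoint)
open import Data.List.Relation.Binary.Permutation.Propositional using (_↭_; ↭-sym; ↭⇒↭ₛ)
open import Data.List.Relation.Binary.Permutation.Propositional.Properties using (↭-reverse; ++-comm; shifts; ↭-length; ∈-resp-↭)
import Data.List.Relation.Binary.Permutation.Setoid.Properties as Permutationₛ
open import Relation.Binary using (Rel; Symmetric)
open import Relation.Binary.Construct.Union using (_∪_)
open import Relation.Binary.PropositionalEquality using (_≡_; _≢_; refl; sym; trans; cong; cong₂; subst; setoid; module ≡-Reasoning)
open import Relation.Nullary using (Dec; yes; no)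
open import Relation.Nullary.Decidable using (_⊎-dec_; map′)
open import Relation.Unary using (Pred; ∁)

private
  variable
    V : Set
    E F : Rel V 0ℓ
    u v w x a : V
    xs ys zs A A′ B B′ J M R : List V

unique-↭ : xs ↭ ys → Unique xs → Unique ys
unique-↭ p = Permutationₛ.Unique-resp-↭ (setoid _) (↭⇒↭ₛ p)

unique-reverse : Unique xs → Unique (reverse xs)
unique-reverse = unique-↭ (↭-sym (↭-reverse _))

unique-++⁻ : ∀ xs → Unique (xs ++ ys) → Unique xs × Unique ys × Disjoint xs ys
unique-++⁻ [] distinct = [] , distinct , λ ()
unique-++⁻ (x ∷ xs) (x∉ ∷ distinct) with unique-++⁻ xs distinct
... | uxs , uys , disjoint = All.++⁻ˡ xs x∉ ∷ uxs , uys , λ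
  { (here refl , v∈ys) → All.lookup (All.++⁻ʳ xs x∉) v∈ys refl
  ; (there v∈xs , v∈ys) → disjoint (v∈xs , v∈ys) }

unique-replaceInfix : ∀ A {M B} → Unique (A ++ M ++ B) → Unique J → Disjoint J (A ++ B) →
                      Unique (A ++ J ++ B)
unique-replaceInfix {J = J} A {M} {B} AMB-unique J-unique disjoint =
  unique-↭ (shifts J A) (Unique.++⁺ J-unique AB-unique disjoint)
  where
  AB-unique : Unique (A ++ B)
  AB-unique = proj₁ (proj₂ (unique-++⁻ M (unique-↭ (shifts A M) AMB-unique)))

unique-infix-ends-distinct : ∀ A → Unique (A ++ u ∷ M ++ w ∷ B) → u ≢ w
unique-infix-ends-distinct {M = M} A distinct with proj₁ (proj₂ (unique-++⁻ A distinct))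
... | u∉ ∷ _ = All.lookup u∉ (∈-++⁺ʳ M (here refl))

-- V need not have decidable equality, but members of a duplicate-free list are
-- equal exactly when they occur at the same position.
decEq-unique : Unique xs → v ∈ xs → w ∈ xs → Dec (v ≡ w)
decEq-unique _ (here refl) (here refl) = yes refl
decEq-unique (v∉ ∷ _) (here refl) (there w∈) = no λ v≡w → All.lookup v∉ w∈ v≡w
decEq-unique (w∉ ∷ _) (there v∈) (here refl) = no λ v≡w → All.lookup w∉ v∈ (sym v≡w)
decEq-unique (_ ∷ distinct) (there v∈) (there w∈) = decEq-unique distinct v∈ w∈

∈?-⊆-unique : Unique xs → ys ⊆ xs → v ∈ xs → Dec (v ∈ ys)
∈?-⊆-unique {ys = []} _ _ _ = no λ ()
∈?-⊆-unique {ys = y ∷ ys} distinct ys⊆ v∈ =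
  map′ [ here , there ]′ (λ { (here v≡y) → inj₁ v≡y ; (there v∈ys) → inj₂ v∈ys })
       (decEq-unique distinct v∈ (ys⊆ (here refl)) ⊎-dec ∈?-⊆-unique distinct (λ y∈ → ys⊆ (there y∈)) v∈)

module _ {Q : Pred V 0ℓ} where

  split-first : All (Dec ∘ Q) xs → All (∁ Q) xs ⊎ ∃₂ λ A R → ∃ λ u → xs ≡ A ++ u ∷ R × All (∁ Q) A × Q u
  split-first [] = inj₁ []
  split-first {xs = x ∷ xs} (yes qx ∷ _) = inj₂ ([] , xs , x , refl , [] , qx)
  split-first {xs = x ∷ xs} (no ¬qx ∷ ds) with split-first ds
  ... | inj₁ none = inj₁ (¬qx ∷ none)
  ... | inj₂ (A , R , u , refl , nA , qu) = inj₂ (x ∷ A , R , u , refl , ¬qx ∷ nA , qu)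

  split-last : All (Dec ∘ Q) xs → All (∁ Q) xs ⊎ ∃₂ λ M B → ∃ λ w → xs ≡ M ++ w ∷ B × Q w × All (∁ Q) B
  split-last [] = inj₁ []
  split-last {xs = x ∷ xs} (d ∷ ds) with split-last ds | d
  ... | inj₂ (M , B , w , refl , qw , nB) | _ = inj₂ (x ∷ M , B , w , refl , qw , nB)
  ... | inj₁ none | yes qx = inj₂ ([] , xs , x , refl , qx , none)
  ... | inj₁ none | no ¬qx = inj₁ (¬qx ∷ none)

  data FirstLastView : List V → Set where
    firstLast : ∀ A {u} M {w} B → All (∁ Q) A → Q u → Q w → All (∁ Q) B →
                FirstLastView (A ++ u ∷ M ++ w ∷ B)

  only-satisfier : ∀ A → All (∁ Q) A → All (∁ Q) R → v ∈ A ++ u ∷ R → Q v → v ≡ u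
  only-satisfier A nA nR v∈ qv with ∈-++⁻ A v∈
  ... | inj₁ v∈A = ⊥-elim (All.lookup nA v∈A qv)
  ... | inj₂ (here v≡u) = v≡u
  ... | inj₂ (there v∈R) = ⊥-elim (All.lookup nR v∈R qv)

  firstLastView : All (Dec ∘ Q) xs → v ∈ xs → w ∈ xs → v ≢ w → Q v → Q w → FirstLastView xs
  firstLastView ds v∈ w∈ v≢w qv qw with split-first ds
  ... | inj₁ none = ⊥-elim (All.lookup none v∈ qv)
  ... | inj₂ (A , R , u , refl , nA , qu) with split-last (All.tail (All.++⁻ʳ A ds))
  ...   | inj₂ (M , B , w′ , refl , qw′ , nB) = firstLast A M B nA qu qw′ nB
  ...   | inj₁ nR =
    ⊥-elim (v≢w (trans (only-satisfier A nA nR v∈ qv) (sym (only-satisfier A nA nR w∈ qw))))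

prefix-shape : ∀ A → A ++ u ∷ R ≡ x ∷ ys → ∃ λ A′ → A ∷ʳ u ≡ x ∷ A′
prefix-shape [] refl = [] , refl
prefix-shape {u = u} (y ∷ A) refl = A ∷ʳ u , refl

suffix-shape : ∀ L → L ++ w ∷ B ≡ zs ∷ʳ a → ∃ λ B′ → w ∷ B ≡ B′ ∷ʳ a
suffix-shape {w = w} {B = B} L eq with initLast B
... | [] = [] , cong [_] (∷ʳ-injectiveʳ L _ eq)
... | B₀ ∷ʳ′ b = w ∷ B₀ , cong (λ c → w ∷ B₀ ∷ʳ c)
                   (∷ʳ-injectiveʳ (L ++ w ∷ B₀) _ (trans (++-assoc L (w ∷ B₀) [ b ]) eq))

linked-consec : ∀ (xs : List V) → Linked (Consec xs) xs
linked-consec [] = []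
linked-consec (x ∷ []) = [-]
linked-consec (x ∷ y ∷ xs) = here ∷ Linked.map there (linked-consec (y ∷ xs))

linked⇒consec : Linked E xs → Consec xs u v → E u v
linked⇒consec (e ∷ _) here = e
linked⇒consec (_ ∷ l) (there c) = linked⇒consec l c
linked⇒consec [-] (there ())

consec-∈ : Consec xs u v → u ∈ xs × v ∈ xs
consec-∈ here = here refl , there (here refl)
consec-∈ (there c) = Product.map there there (consec-∈ c)

PathEdge-∈ : PathEdge xs u v → u ∈ xs × v ∈ xs
PathEdge-∈ (inj₁ c) = consec-∈ c
PathEdge-∈ (inj₂ c) = Product.swap (consec-∈ c)

linked-join : ∀ xs → Linked E (xs ∷ʳ v) → Linked E (v ∷ ys) → Linked E (xs ++ v ∷ ys)
linked-join [] _ l = l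
linked-join (x ∷ []) (e ∷ _) l = e ∷ l
linked-join (x ∷ y ∷ xs) (e ∷ l′) l = e ∷ linked-join (y ∷ xs) l′ l

linked-split : ∀ xs → Linked E (xs ++ v ∷ ys) → Linked E (xs ∷ʳ v) × Linked E (v ∷ ys)
linked-split [] l = [-] , l
linked-split (x ∷ []) (e ∷ l) = e ∷ [-] , l
linked-split (x ∷ y ∷ xs) (e ∷ l) with linked-split (y ∷ xs) l
... | l₁ , l₂ = e ∷ l₁ , l₂

linked-ʳ++ : Symmetric E → Linked E (v ∷ xs) → Linked E (v ∷ ys) → Linked E (xs ʳ++ v ∷ ys)
linked-ʳ++ E-sym [-] l = l
linked-ʳ++ E-sym (e ∷ l′) l = linked-ʳ++ E-sym l′ (E-sym e ∷ l)

linked-reverse : Symmetric E → Linked E xs → Linked E (reverse xs)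
linked-reverse E-sym [] = []
linked-reverse E-sym [-] = [-]
linked-reverse E-sym (e ∷ l) = linked-ʳ++ E-sym l (E-sym e ∷ [-])

linked-All : ∀ {U : Pred V 0ℓ} → (∀ {u v} → E u v → U u × U v) →
             ∀ xs → Linked E (u ∷ xs ∷ʳ w) → All U (u ∷ xs ∷ʳ w)
linked-All ends [] (e ∷ _) = proj₁ (ends e) ∷ proj₂ (ends e) ∷ []
linked-All ends (_ ∷ xs) (e ∷ l) = proj₁ (ends e) ∷ linked-All ends xs l

-- Paths

record Path (E : Rel V 0ℓ) (u w : V) : Set where
  field
    inner  : List V
    unique : Unique (u ∷ inner ∷ʳ w)
    linked : Linked E (u ∷ inner ∷ʳ w)

  vertices : List V
  vertices = u ∷ inner ∷ʳ w

  length : ℕ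
  length = suc (List.length inner)

reverse-∷-∷ʳ : ∀ (xs : List V) → reverse (u ∷ xs ∷ʳ w) ≡ w ∷ reverse xs ∷ʳ u
reverse-∷-∷ʳ {u = u} {w = w} xs = trans (unfold-reverse u (xs ∷ʳ w)) (cong (_∷ʳ u) (reverse-++ xs [ w ]))

Path-reverse : Symmetric E → Path E u w → Path E w u
Path-reverse {E = E} E-sym p = record
  { inner  = reverse inner
  ; unique = subst Unique (reverse-∷-∷ʳ inner) (unique-reverse unique)
  ; linked = subst (Linked E) (reverse-∷-∷ʳ inner) (linked-reverse E-sym linked)
  }
  where open Path p

length-Path-reverse : (E-sym : Symmetric E) (p : Path E u w) →
                      Path.length (Path-reverse E-sym p) ≡ Path.length p
length-Path-reverse _ p = cong suc (length-reverse (Path.inner p))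

Path-ends-distinct : Path E u w → u ≢ w
Path-ends-distinct p u≡w with Path.unique p
... | u∉ ∷ _ = All.lookup u∉ (∈-++⁺ʳ (Path.inner p) (here refl)) u≡w

Path-end∉inner : (p : Path E u w) → w ∉ Path.inner p
Path-end∉inner p w∈ with Path.unique p
... | _ ∷ distinct = proj₂ (proj₂ (unique-++⁻ (Path.inner p) distinct)) (w∈ , here refl)

Path-All : ∀ {U : Pred V 0ℓ} → (∀ {u v} → E u v → U u × U v) →
           (p : Path E u w) → All U (Path.vertices p)
Path-All ends p = linked-All ends (Path.inner p) (Path.linked p)

module _ (p : Path E u x) (q : Path F x w) where
  private
    module p = Path p
    module q = Path q

    glued≡ : u ∷ (p.inner ++ x ∷ q.inner) ∷ʳ w ≡ (u ∷ p.inner) ++ q.vertices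
    glued≡ = cong (u ∷_) (++-assoc p.inner (x ∷ q.inner) [ w ])

  Path-glue : (∀ {v} → v ∈ p.vertices → v ∈ q.vertices → v ≡ x) → Path (E ∪ F) u w
  Path-glue meet = record
    { inner  = p.inner ++ x ∷ q.inner
    ; unique = subst Unique (sym glued≡) (Unique.++⁺ u∷inner q.unique disjoint)
    ; linked = subst (Linked (E ∪ F)) (sym glued≡)
                 (linked-join (u ∷ p.inner) (Linked.map inj₁ p.linked) (Linked.map inj₂ q.linked))
    }
    where
    split = unique-++⁻ (u ∷ p.inner) p.unique
    u∷inner = proj₁ split
    disjoint : Disjoint (u ∷ p.inner) q.vertices
    disjoint (v∈ , v∈q) with meet (∈-++⁺ˡ v∈) v∈q
    ... | refl = proj₂ (proj₂ split) (v∈ , here refl)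

  length-Path-glue : (meet : ∀ {v} → v ∈ p.vertices → v ∈ q.vertices → v ≡ x) →
                     Path.length (Path-glue meet) ≡ p.length + q.length
  length-Path-glue _ = cong suc (length-++ p.inner)

-- Arcs of a cycle

CycleEdge-sym : ∀ {C : List V} → Symmetric (CycleEdge C)
CycleEdge-sym = Sum.swap

linked-closedWalk : ∀ (C : List V) → Linked (CycleEdge C) (C ++ take 1 C)
linked-closedWalk C = Linked.map inj₁ (linked-consec (C ++ take 1 C))

closedWalk-⊆ : ∀ (C : List V) → C ++ take 1 C ⊆ C
closedWalk-⊆ (c ∷ C) v∈ with ∈-++⁻ (c ∷ C) v∈
... | inj₁ v∈C = v∈C
... | inj₂ (here refl) = here refl

CycleEdge-∈ : ∀ {C : List V} → CycleEdge C u v → u ∈ C × v ∈ C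
CycleEdge-∈ {C = C} e = Product.map (closedWalk-⊆ C) (closedWalk-⊆ C) (PathEdge-∈ e)

linked-rotate : ∀ A → Linked E ((A ++ u ∷ R) ++ take 1 (A ++ u ∷ R)) → Linked E (u ∷ (R ++ A) ∷ʳ u)
linked-rotate {E = E} {u = u} {R = R} [] l = subst (λ t → Linked E (u ∷ t ∷ʳ u)) (sym (++-identityʳ R)) l
linked-rotate {E = E} {u = u} {R = R} (y ∷ A) l
  with linked-split (y ∷ A) (subst (Linked E) (++-assoc (y ∷ A) (u ∷ R) [ y ]) l)
... | y∷A∷ʳu , u∷R∷ʳy =
  subst (Linked E) (cong (u ∷_) (sym (++-assoc R (y ∷ A) [ u ]))) (linked-join (u ∷ R) u∷R∷ʳy y∷A∷ʳu)

closedWalk-arcs : Unique (u ∷ R) → Linked E (u ∷ R ∷ʳ u) → w ∈ R →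
                  Σ (Path E u w) λ p → Σ (Path E w u) λ q →
                    Path.length p + Path.length q ≡ suc (List.length R)
closedWalk-arcs {u = u} {E = E} {w = w} uR lR w∈ with ∈-∃++ w∈
... | Y , Z , refl = p , q , cong suc (sym (length-++ Y))
  where
  walk = linked-split (u ∷ Y) (subst (Linked E) (cong (u ∷_) (++-assoc Y (w ∷ Z) [ u ])) lR)

  p : Path E u w
  p = record
    { inner  = Y
    ; unique = proj₁ (unique-++⁻ (u ∷ Y ∷ʳ w) (subst Unique (cong (u ∷_) (sym (∷ʳ-++ Y w Z))) uR))
    ; linked = proj₁ walk
    }

  q : Path E w u
  q = record
    { inner  = Z
    ; unique = proj₁ (unique-++⁻ (w ∷ Z ∷ʳ u)
                 (subst Unique (cong (w ∷_) (sym (∷ʳ-++ Z u Y))) (unique-↭ (++-comm (u ∷ Y) (w ∷ Z)) uR)))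
    ; linked = proj₂ walk
    }

cycle-arcs : ∀ {C : List V} → Unique C → u ∈ C → w ∈ C → u ≢ w →
             Σ (Path (CycleEdge C) u w) λ p → Σ (Path (CycleEdge C) u w) λ q →
               Path.length p + Path.length q ≡ List.length C
cycle-arcs {u = u} {w = w} uC u∈ w∈ u≢w with ∈-∃++ u∈
... | A , R , refl = p , Path-reverse E-sym q , lengths
  where
  E-sym = CycleEdge-sym {C = A ++ u ∷ R}

  rotation : A ++ u ∷ R ↭ u ∷ R ++ A
  rotation = ++-comm A (u ∷ R)

  w∈R++A : w ∈ R ++ A
  w∈R++A with ∈-resp-↭ rotation w∈
  ... | here refl = ⊥-elim (u≢w refl)
  ... | there w∈′ = w∈′

  arcs = closedWalk-arcs {E = CycleEdge (A ++ u ∷ R)} (unique-↭ rotation uC)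
           (linked-rotate A (linked-closedWalk (A ++ u ∷ R))) w∈R++A
  p = proj₁ arcs
  q = proj₁ (proj₂ arcs)

  lengths : Path.length p + Path.length (Path-reverse E-sym q) ≡ List.length (A ++ u ∷ R)
  lengths = begin
    Path.length p + Path.length (Path-reverse E-sym q) ≡⟨ cong (Path.length p +_) (length-Path-reverse E-sym q) ⟩
    Path.length p + Path.length q                      ≡⟨ proj₂ (proj₂ arcs) ⟩
    List.length (u ∷ R ++ A)                           ≡⟨ ↭-length rotation ⟨
    List.length (A ++ u ∷ R)                           ∎
    where open ≡-Reasoning

-- Parity

parity-odd : ∀ {n} → Odd n → parity n ≡ 1ℙ
parity-odd (k , refl) = trans (ℙ.+-homo-+ 1 (2 * k)) (cong (1ℙ ℙ.+_) (ℙ.*-homo-* 2 k))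

one-of-two-even : ∀ n i j → parity (i + j) ≡ 1ℙ → parity (n + i) ≡ 0ℙ ⊎ parity (n + j) ≡ 0ℙ
one-of-two-even n i j odd
  rewrite ℙ.+-homo-+ n i | ℙ.+-homo-+ n j | ℙ.+-homo-+ i j = choose (parity n) (parity i) (parity j) odd
  where
  choose : ∀ p q r → q ℙ.+ r ≡ 1ℙ → p ℙ.+ q ≡ 0ℙ ⊎ p ℙ.+ r ≡ 0ℙ
  choose 0ℙ 0ℙ _  _ = inj₁ refl
  choose 1ℙ 1ℙ _  _ = inj₁ refl
  choose 0ℙ 1ℙ 0ℙ _ = inj₂ refl
  choose 1ℙ 0ℙ 1ℙ _ = inj₂ refl
  choose _  0ℙ 0ℙ ()
  choose _  1ℙ 1ℙ ()

even⇒2∣ : ∀ n → parity n ≡ 0ℙ → 2 ∣ n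
even⇒2∣ zero _ = 2 ∣0
even⇒2∣ (suc (suc n)) even = ∣m∣n⇒∣m+n ∣-refl (even⇒2∣ n even)

4∣-sum-of-evens : ∀ {m n} (d : 2 ∣ m) (e : 2 ∣ n) →
                  parity (_∣_.quotient d) ≡ parity (_∣_.quotient e) → 4 ∣ m + n
4∣-sum-of-evens (divides q refl) (divides r refl) same =
  subst (4 ∣_) (*-distribʳ-+ 2 q r) (*-monoˡ-∣ 2 (even⇒2∣ (q + r) even))
  where
  even : parity (q + r) ≡ 0ℙ
  even = trans (ℙ.+-homo-+ q r) (trans (cong (ℙ._+ parity r) same) (ℙ.p+p≡0ℙ (parity r)))

two-of-three : (p : Fin 3 → Parity) → ∃₂ λ i j → i ≢ j × p i ≡ p j
two-of-three p with p zero ℙ.≟ p (suc zero) | p zero ℙ.≟ p (suc (suc zero))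
... | yes e | _     = zero , suc zero , (λ ()) , e
... | no _  | yes e = zero , suc (suc zero) , (λ ()) , e
... | no ne₁ | no ne₂ = suc zero , suc (suc zero) , (λ ()) , third ne₁ ne₂
  where
  third : ∀ {p q r : Parity} → p ≢ q → p ≢ r → q ≡ r
  third {0ℙ} {1ℙ} {1ℙ} _ _ = refl
  third {1ℙ} {0ℙ} {0ℙ} _ _ = refl
  third {0ℙ} {0ℙ} ne _ = ⊥-elim (ne refl)
  third {1ℙ} {1ℙ} ne _ = ⊥-elim (ne refl)
  third {0ℙ} {1ℙ} {0ℙ} _ ne = ⊥-elim (ne refl)
  third {1ℙ} {0ℙ} {1ℙ} _ ne = ⊥-elim (ne refl)

-- Detours through an odd cycle

module _ {E F : Rel V 0ℓ} (A : List V) {M B : List V}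
         (uP : Unique (A ++ u ∷ M ++ w ∷ B)) (lP : Linked E (A ++ u ∷ M ++ w ∷ B))
         (A∷ʳu≡ : A ∷ʳ u ≡ x ∷ A′) (w∷B≡ : w ∷ B ≡ B′ ∷ʳ a) where

  detour : (p : Path F u w) → Disjoint (Path.vertices p) (A ++ B) →
           Σ (Path (E ∪ F) x a) λ h → Path.length h ≡ (List.length A′ + List.length B′) + Path.length p
  detour p disjoint = h , length-h
    where
    I = Path.inner p

    infix≡ : ∀ J → A ++ (u ∷ J ∷ʳ w) ++ B ≡ A ++ u ∷ J ++ w ∷ B
    infix≡ J = cong (λ t → A ++ u ∷ t) (∷ʳ-++ J w B)

    shape : A ++ u ∷ I ++ w ∷ B ≡ x ∷ (A′ ++ I ++ B′) ∷ʳ a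
    shape = begin
      A ++ u ∷ I ++ w ∷ B           ≡⟨ ∷ʳ-++ A u (I ++ w ∷ B) ⟨
      (A ∷ʳ u) ++ I ++ w ∷ B        ≡⟨ cong₂ (λ s t → s ++ I ++ t) A∷ʳu≡ w∷B≡ ⟩
      x ∷ A′ ++ I ++ B′ ∷ʳ a        ≡⟨ cong (λ t → x ∷ A′ ++ t) (++-assoc I B′ [ a ]) ⟨
      x ∷ A′ ++ (I ++ B′) ∷ʳ a      ≡⟨ cong (x ∷_) (++-assoc A′ (I ++ B′) [ a ]) ⟨
      x ∷ (A′ ++ I ++ B′) ∷ʳ a      ∎
      where open ≡-Reasoning

    unique : Unique (A ++ u ∷ I ++ w ∷ B)
    unique = subst Unique (infix≡ I)
               (unique-replaceInfix A (subst Unique (sym (infix≡ M)) uP) (Path.unique p) disjoint)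

    linked : Linked (E ∪ F) (A ++ u ∷ I ++ w ∷ B)
    linked with linked-split A lP
    ... | A∷ʳu , u∷M++w∷B = linked-join A (Linked.map inj₁ A∷ʳu)
          (linked-join (u ∷ I) (Linked.map inj₂ (Path.linked p)) (Linked.map inj₁ w∷B))
      where w∷B = proj₂ (linked-split (u ∷ M) u∷M++w∷B)

    h : Path (E ∪ F) x a
    h = record
      { inner  = A′ ++ I ++ B′
      ; unique = subst Unique shape unique
      ; linked = subst (Linked (E ∪ F)) shape linked
      }

    length-h : Path.length h ≡ (List.length A′ + List.length B′) + Path.length p
    length-h = trans (cong suc (trans (length-++ A′) (cong (List.length A′ +_) (length-++ I))))
                     (arithmetic (List.length A′) (List.length B′) (List.length I))
      where
      arithmetic : ∀ m n i → suc (m + (i + n)) ≡ (m + n) + suc i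
      arithmetic = solve-∀

  even-detour : (p q : Path F u w) →
                Disjoint (Path.vertices p) (A ++ B) → Disjoint (Path.vertices q) (A ++ B) →
                parity (Path.length p + Path.length q) ≡ 1ℙ → Σ (Path (E ∪ F) x a) λ h → 2 ∣ Path.length h
  even-detour p q p-avoids q-avoids odd
    with one-of-two-even (List.length A′ + List.length B′) (Path.length p) (Path.length q) odd
  ... | inj₁ even = Product.map₂ (λ h≡ → subst (2 ∣_) (sym h≡) (even⇒2∣ _ even)) (detour p p-avoids)
  ... | inj₂ even = Product.map₂ (λ h≡ → subst (2 ∣_) (sym h≡) (even⇒2∣ _ even)) (detour q q-avoids)

module _ {P C : List V} where

  intersection-∈? : Unique P → IntersectionIsPath≥1 P C → v ∈ P → Dec (v ∈ C)
  intersection-∈? uP (Q , _ , _ , Q≡P∩C , _) v∈P =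
    map′ (proj₂ ∘ to) (λ v∈C → Equivalence.from (Q≡P∩C _) (v∈P , v∈C))
         (∈?-⊆-unique uP (proj₁ ∘ to) v∈P)
    where
    to : ∀ {v} → v ∈ Q → v ∈ P × v ∈ C
    to = Equivalence.to (Q≡P∩C _)

  intersection-pair : IntersectionIsPath≥1 P C →
                      ∃₂ λ q₀ q₁ → q₀ ≢ q₁ × (q₀ ∈ P × q₀ ∈ C) × (q₁ ∈ P × q₁ ∈ C)
  intersection-pair (q₀ ∷ q₁ ∷ _ , (q₀∉ ∷ _ , _) , _ , Q≡P∩C , _) =
    q₀ , q₁ , All.lookup q₀∉ (here refl) ,
    Equivalence.to (Q≡P∩C q₀) (here refl) , Equivalence.to (Q≡P∩C q₁) (there (here refl))
  intersection-pair (_ ∷ [] , _ , s≤s () , _)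

even-path : ∀ {P C : List V} → IsPathFromTo x a P → Unique C → Odd (List.length C) →
            IntersectionIsPath≥1 P C → Σ (Path (PathEdge P ∪ CycleEdge C) x a) λ h → 2 ∣ Path.length h
even-path {C = C} (uP , (_ , P≡x∷) , (_ , P≡∷ʳa)) uC oddC P∩C with intersection-pair P∩C
... | q₀ , q₁ , q₀≢q₁ , (q₀∈P , q₀∈C) , (q₁∈P , q₁∈C)
  with firstLastView (All.tabulate (intersection-∈? uP P∩C)) q₀∈P q₁∈P q₀≢q₁ q₀∈C q₁∈C
... | firstLast A {u} M {w} B A∌C u∈C w∈C B∌C
  with cycle-arcs uC u∈C w∈C (unique-infix-ends-distinct A uP)
... | p , q , p+q≡C =
  even-detour A uP (Linked.map inj₁ (linked-consec _)) (proj₂ (prefix-shape A P≡x∷))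
    (proj₂ (suffix-shape (A ++ u ∷ M) (trans (++-assoc A (u ∷ M) (w ∷ B)) P≡∷ʳa)))
    p q (avoids p) (avoids q) (trans (cong parity p+q≡C) (parity-odd oddC))
  where
  avoids : (r : Path (CycleEdge C) u w) → Disjoint (Path.vertices r) (A ++ B)
  avoids r (v∈r , v∈A++B) =
    All.lookup (All.++⁺ A∌C B∌C) v∈A++B (All.lookup (Path-All CycleEdge-∈ r) v∈r)

-- Windmills

module WindmillArms {V : Set} (W : Windmill V) where
  open Windmill W renaming (x to centre; a to tip)

  Piece : Fin 3 → V → Set
  Piece k v = v ∈ P k ⊎ v ∈ C k

  PieceEdge : Fin 3 → Rel V 0ℓ
  PieceEdge k = PathEdge (P k) ∪ CycleEdge (C k)

  PieceEdge-sym : ∀ k → Symmetric (PieceEdge k)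
  PieceEdge-sym k = Sum.map Sum.swap Sum.swap

  PieceEdge-∈ : ∀ k {u v} → PieceEdge k u v → Piece k u × Piece k v
  PieceEdge-∈ k (inj₁ e) = Product.map inj₁ inj₁ (PathEdge-∈ e)
  PieceEdge-∈ k (inj₂ e) = Product.map inj₂ inj₂ (CycleEdge-∈ e)

  pieces-meet-at-centre : ∀ {i j} → i ≢ j → ∀ {v} → Piece i v → Piece j v → v ≡ centre
  pieces-meet-at-centre {i} {j} i≢j (inj₁ v∈Pᵢ) (inj₁ v∈Pⱼ) = P-disj i j i≢j _ v∈Pᵢ v∈Pⱼ
  pieces-meet-at-centre {i} {j} i≢j (inj₂ v∈Cᵢ) (inj₁ v∈Pⱼ) = ⊥-elim (proj₁ (C-disj i j i≢j _ v∈Cᵢ) v∈Pⱼ)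
  pieces-meet-at-centre {i} {j} i≢j (inj₂ v∈Cᵢ) (inj₂ v∈Cⱼ) = ⊥-elim (proj₂ (C-disj i j i≢j _ v∈Cᵢ) v∈Cⱼ)
  pieces-meet-at-centre {i} {j} i≢j (inj₁ v∈Pᵢ) (inj₂ v∈Cⱼ) =
    ⊥-elim (proj₁ (C-disj j i (i≢j ∘ sym) _ v∈Cⱼ) v∈Pᵢ)

  arm : ∀ k → Σ (Path (PieceEdge k) centre (tip k)) λ h → 2 ∣ Path.length h
  arm k = even-path (P-path k) (proj₁ (C-cycle k)) (C-odd k) (C∩P k)

  arm-in-piece : ∀ k → All (Piece k) (Path.vertices (proj₁ (arm k)))
  arm-in-piece k = Path-All (PieceEdge-∈ k) (proj₁ (arm k))

  tip∈P : ∀ k → tip k ∈ P k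
  tip∈P k with P-path k
  ... | _ , _ , zs , P≡zs∷ʳtip = subst (tip k ∈_) (sym P≡zs∷ʳtip) (∈-++⁺ʳ zs (here refl))

  centre≢tip : ∀ k → centre ≢ tip k
  centre≢tip k = Path-ends-distinct (proj₁ (arm k))

  tip∉arm : ∀ k l → tip k ∉ Path.inner (proj₁ (arm l))
  tip∉arm k l tip∈ with k ≟ l
  ... | yes refl = Path-end∉inner (proj₁ (arm k)) tip∈
  ... | no k≢l = centre≢tip k (sym (pieces-meet-at-centre k≢l (inj₁ (tip∈P k))
                   (All.lookup (arm-in-piece l) (there (∈-++⁺ˡ tip∈)))))

  module _ {i j : Fin 3} (i≢j : i ≢ j) where
    private
      hᵢ = Path-reverse (PieceEdge-sym i) (proj₁ (arm i))
      hⱼ = proj₁ (arm j)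

      meet : ∀ {v} → v ∈ Path.vertices hᵢ → v ∈ Path.vertices hⱼ → v ≡ centre
      meet v∈hᵢ v∈hⱼ = pieces-meet-at-centre i≢j (All.lookup (Path-All (PieceEdge-∈ i) hᵢ) v∈hᵢ)
                                                  (All.lookup (arm-in-piece j) v∈hⱼ)

    tip-to-tip : Path (PieceEdge i ∪ PieceEdge j) (tip i) (tip j)
    tip-to-tip = Path-glue hᵢ hⱼ meet

    length-tip-to-tip : Path.length tip-to-tip ≡
                        Path.length (proj₁ (arm i)) + Path.length (proj₁ (arm j))
    length-tip-to-tip = trans (length-Path-glue hᵢ hⱼ meet)
                          (cong (_+ Path.length hⱼ) (length-Path-reverse (PieceEdge-sym i) (proj₁ (arm i))))

    tip∉tip-to-tip : ∀ k → tip k ∉ Path.inner tip-to-tip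
    tip∉tip-to-tip k tip∈ with ∈-++⁻ (Path.inner hᵢ) tip∈
    ... | inj₁ tip∈hᵢ = tip∉arm k i (reverse⁻ tip∈hᵢ)
    ... | inj₂ (here tip≡centre) = centre≢tip k (sym tip≡centre)
    ... | inj₂ (there tip∈hⱼ) = tip∉arm k j tip∈hⱼ

  half-parity : Fin 3 → Parity
  half-parity k = parity (_∣_.quotient (proj₂ (arm k)))

  good-tip-path : ∀ {i j} → i ≢ j → half-parity i ≡ half-parity j → GoodTipPath W
  good-tip-path {i} {j} i≢j same =
    i , j , Path.inner h , Path.unique h , Path-ends-distinct h ,
    (λ _ _ c → [ (i ,_) , (j ,_) ]′ (linked⇒consec (Path.linked h) c)) ,
    subst (4 ∣_) (sym (length-tip-to-tip i≢j)) (4∣-sum-of-evens (proj₂ (arm i)) (proj₂ (arm j)) same) ,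
    tip∉tip-to-tip i≢j
    where
    h = tip-to-tip i≢j

lemma9 : {V : Set} (W : Windmill V) → GoodTipPath W
lemma9 W = let i , j , i≢j , same = two-of-three half-parity in good-tip-path i≢j same
  where open WindmillArms W
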